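{- Let $T_1,T_2$ be labeled ordered rooted trees and $k\ge 0$ an integer with $\mathsf{ed}(T_1,T_2)\le k$. Let $S$ be the set of all states $(F_1,F_2)$, with $F_i$ a subforest of $T_i$, such that $|\mathsf{size}(F_1)-\mathsf{size}(F_2)|>k$. Then $V_S(T_1,T_2)=\mathsf{ed}(T_1,T_2)$.
   Context: Ordered rooted trees and forests: children of each node are linearly ordered, a forest is a linearly ordered sequence of trees; nodes carry labels. Removing a node $v$ from a forest deletes $v$ and puts its children, in order, in the place of $v$ (in its parent's child list or among the trees). $\mathsf{ed}(F_1,F_2)$ is the minimum number of single-node relabelings and single-node removals applied to $F_1$ and $F_2$ so that the resulting labeled ordered forests are identical. For a nonempty forest $F$: $L_F,R_F$ are its leftmost and rightmost trees, $\ell_F,r_F$ their roots; $L'_F$ is $F$ without the tree $R_F$, $R'_F$ is $F$ without $L_F$; $R^\circ_F$ is $R_F$ with $r_F$ removed, $L^\circ_F$ is $L_F$ with $\ell_F$ removed; $F-v$ is $F$ with node $v$ removed; $\mathsf{size}$ is the number of nodes. A subforest of a tree $T$ is a forest obtained from $T$ by repeatedly removing the leftmost or rightmost root. Let $\delta(x,y)=1$ if nodes $x,y$ have different labels and $0$ otherwise. A state is a pair $(F_1,F_2)$ with $F_i$ a subforest of $T_i$. For a set $S$ of states, define $V_S$ on states by recursion on $\mathsf{size}(F_1)+\mathsf{size}(F_2)$: $V_S(F_1,F_2)=+\infty$ if $(F_1,F_2)\in S$; otherwise $V_S(F_1,\emptyset)=\mathsf{size}(F_1)$, $V_S(\emptyset,F_2)=\mathsf{size}(F_2)$;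 otherwise, if $\mathsf{size}(L_{F_1})>\mathsf{size}(R_{F_1})$, $V_S(F_1,F_2)=\min\{V_S(F_1-r_{F_1},F_2)+1,\ V_S(F_1,F_2-r_{F_2})+1,\ V_S(R^\circ_{F_1},R^\circ_{F_2})+V_S(L'_{F_1},L'_{F_2})+\delta(r_{F_1},r_{F_2})\}$, and otherwise $V_S(F_1,F_2)=\min\{V_S(F_1-\ell_{F_1},F_2)+1,\ V_S(F_1,F_2-\ell_{F_2})+1,\ V_S(L^\circ_{F_1},L^\circ_{F_2})+V_S(R'_{F_1},R'_{F_2})+\delta(\ell_{F_1},\ell_{F_2})\}$. (With $S=\emptyset$ this recursion computes $\mathsf{ed}$.) -}

module Defs where

open import Data.Nat using (ℕ; zero; suc; _+_; _≤_; _<_; _<ᵇ_; ∣_-_∣)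
open import Data.Nat.Properties using ()
open import Data.List using (List; []; _∷_; _++_)
open import Data.Product using (_×_; _,_; proj₁; proj₂; ∃; ∃-syntax)
open import Data.Bool using (Bool; true; false; if_then_else_)
open import Relation.Nullary using (Dec; yes; no)
open import Relation.Binary.Definitions using (DecidableEquality)

data Tree (A : Set) : Set where
  node : A → List (Tree A) → Tree A

Forest : Set → Set
Forest A = List (Tree A)

module _ {A : Set} where

  mutual
    sizeT : Tree A → ℕ
    sizeT (node _ ts) = suc (sizeF ts)

    sizeF : Forest A → ℕ
    sizeF []       = 0
    sizeF (t ∷ ts) = sizeT t + sizeF ts

  label : Tree A → A
  label (node a _) = a

  children : Tree A → Forest A
  children (node _ ts) = ts

  data Step : Forest A → Forest A → Set where
    relabel : ∀ a b ts f → Step (node a ts ∷ f) (node b ts ∷ f)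
    remove  : ∀ a ts f → Step (node a ts ∷ f) (ts ++ f)
    inside  : ∀ a {ts ts'} f → Step ts ts' → Step (node a ts ∷ f) (node a ts' ∷ f)
    later   : ∀ t {f f'} → Step f f' → Step (t ∷ f) (t ∷ f')

  data Steps : ℕ → Forest A → Forest A → Set where
    done : ∀ {F} → Steps 0 F F
    step : ∀ {n F G H} → Step F G → Steps n G H → Steps (suc n) F H

  Transformable : Forest A → Forest A → ℕ → Set
  Transformable F₁ F₂ c =
    ∃[ G ] ∃[ c₁ ] ∃[ c₂ ] (Steps c₁ F₁ G × Steps c₂ F₂ G × c₁ + c₂ ≡' c)
    where
      open import Relation.Binary.PropositionalEquality renaming (_≡_ to _≡'_)

  IsEd : Forest A → Forest A → ℕ → Set
  IsEd F₁ F₂ d = Transformable F₁ F₂ d × (∀ c → Transformable F₁ F₂ c → d ≤ c)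

  data IsSubforest (T : Tree A) : Forest A → Set where
    base     : IsSubforest T (T ∷ [])
    delLeft  : ∀ a ts f → IsSubforest T (node a ts ∷ f) → IsSubforest T (ts ++ f)
    delRight : ∀ f a ts → IsSubforest T (f ++ node a ts ∷ []) → IsSubforest T (f ++ ts)

  initLast : Tree A → Forest A → Forest A × Tree A
  initLast t []       = [] , t
  initLast t (u ∷ us) with initLast u us
  ... | i , l = t ∷ i , l

data ℕ∞ : Set where
  fin : ℕ → ℕ∞
  ∞   : ℕ∞

_⊕_ : ℕ∞ → ℕ∞ → ℕ∞
fin m ⊕ fin n = fin (m + n)
_     ⊕ _     = ∞

min∞ : ℕ∞ → ℕ∞ → ℕ∞
min∞ (fin m) (fin n) = fin (Data.Nat._⊓_ m n)
min∞ (fin m) ∞       = fin m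
min∞ ∞       y       = y

-- Defined by recursion on size(F₁)+size(F₂), implemented with a fuel
-- argument; the fuel n = size(F₁)+size(F₂) always suffices, since every
-- recursive call strictly decreases this total (the `zero` fuel case on
-- two nonempty forests is unreachable from V).

module _ {A : Set} (_≟_ : DecidableEquality A)
         (S : Forest A → Forest A → Set)
         (S? : ∀ F₁ F₂ → Dec (S F₁ F₂)) where

  δ : A → A → ℕ
  δ a b with a ≟ b
  ... | yes _ = 0
  ... | no  _ = 1

  go : ℕ → Forest A → Forest A → ℕ∞
  go n F₁ F₂ with S? F₁ F₂
  go n F₁ F₂ | yes _ = ∞
  go n [] F₂ | no _ = fin (sizeF F₂)
  go n F₁@(_ ∷ _) [] | no _ = fin (sizeF F₁)
  go zero (_ ∷ _) (_ ∷ _) | no _ = ∞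
  go (suc n) F₁@(t₁ ∷ ts₁) F₂@(t₂ ∷ ts₂) | no _
    with initLast t₁ ts₁ | initLast t₂ ts₂
  ... | (L'₁ , node r₁ R°₁) | (L'₂ , node r₂ R°₂) =
    if sizeT t₁ Data.Nat.≤ᵇ sizeT (node r₁ R°₁)
    then
      -- size(L_F₁) ≤ size(R_F₁): operate on the leftmost roots
      min∞ (go n (children t₁ ++ ts₁) F₂ ⊕ fin 1)
      (min∞ (go n F₁ (children t₂ ++ ts₂) ⊕ fin 1)
            ((go n (children t₁) (children t₂) ⊕ go n ts₁ ts₂)
               ⊕ fin (δ (label t₁) (label t₂))))
    else
      -- size(L_F₁) > size(R_F₁): operate on the rightmost roots
      min∞ (go n (L'₁ ++ R°₁) F₂ ⊕ fin 1)
      (min∞ (go n F₁ (L'₂ ++ R°₂) ⊕ fin 1)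
            ((go n R°₁ R°₂ ⊕ go n L'₁ L'₂) ⊕ fin (δ r₁ r₂)))

  V : Forest A → Forest A → ℕ∞
  V F₁ F₂ = go (sizeF F₁ + sizeF F₂) F₁ F₂

{-# OPTIONS --safe #-}
-- A sequence of relabellings and removals taking F₁ and F₂ to a common forest can be
-- normalised, at no greater cost, into two scripts that consume the roots of F₁ and F₂
-- one at a time, each root being either deleted or matched with a root of the common
-- forest.  Every finite value of the recursion V_S is the cost of such a pair of
-- scripts, whatever S is, so V_S ≥ ed.  Conversely, the recursion can follow an
-- optimal pair of scripts: at each state one of its three options deletes or matches
-- the roots the way the scripts do.  The only way this can fail is a state in S, and the
-- states visited never are: a script of cost c changes the size by at most c, so a state
-- reached within total cost ed ≤ k has sizes differing by at most k.
module Submission where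

open import Defs
open import Data.Bool using (true; false)
open import Data.Empty using (⊥-elim)
open import Data.List using (List; []; _∷_; _++_)
open import Data.List.Properties using (++-assoc; ++-identityʳ; ∷-injective; ∷ʳ-injective)
open import Data.Nat using (ℕ; zero; suc; _+_; _≤_; _<_; _≤ᵇ_; z≤n; s≤s; ∣_-_∣)
open import Data.Nat.Properties
open import Algebra.Properties.CommutativeSemigroup +-commutativeSemigroup using (interchange; xy∙z≈xz∙y)
open import Data.Nat.Tactic.RingSolver using (solve-∀)
open import Data.Product using (_×_; _,_; proj₁; proj₂; ∃-syntax; swap)
open import Data.Sum using (_⊎_; inj₁; inj₂)
open import Function.Bundles using (_⇔_; Equivalence)
open import Relation.Nullary using (Dec; yes; no)
open import Relation.Binary.Definitions using (DecidableEquality)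
open import Relation.Binary.PropositionalEquality

infix 4 _≤∞_

data _≤∞_ : ℕ∞ → ℕ → Set where
  fin≤ : ∀ {m n} → m ≤ n → fin m ≤∞ n

≤∞-weaken : ∀ {x m n} → x ≤∞ m → m ≤ n → x ≤∞ n
≤∞-weaken (fin≤ p) q = fin≤ (≤-trans p q)

⊕-≤∞ : ∀ {x y m n} → x ≤∞ m → y ≤∞ n → x ⊕ y ≤∞ m + n
⊕-≤∞ (fin≤ p) (fin≤ q) = fin≤ (+-mono-≤ p q)

⊕1-≤∞ : ∀ {x n} → x ≤∞ n → x ⊕ fin 1 ≤∞ suc n
⊕1-≤∞ {n = n} p = ≤∞-weaken (⊕-≤∞ p (fin≤ ≤-refl)) (≤-reflexive (+-comm n 1))

min∞-≤∞ˡ : ∀ {x n} y → x ≤∞ n → min∞ x y ≤∞ n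
min∞-≤∞ˡ (fin m) (fin≤ p) = fin≤ (≤-trans (m⊓n≤m _ m) p)
min∞-≤∞ˡ ∞       (fin≤ p) = fin≤ p

min∞-≤∞ʳ : ∀ x {y n} → y ≤∞ n → min∞ x y ≤∞ n
min∞-≤∞ʳ (fin m) (fin≤ p) = fin≤ (≤-trans (m⊓n≤n m _) p)
min∞-≤∞ʳ ∞       p        = p

min∞₃-≤∞ : ∀ {x y z n} → x ≤∞ n ⊎ y ≤∞ n ⊎ z ≤∞ n → min∞ x (min∞ y z) ≤∞ n
min∞₃-≤∞ {y = y} {z}     (inj₁ p)        = min∞-≤∞ˡ (min∞ y z) p
min∞₃-≤∞ {x}     {z = z} (inj₂ (inj₁ p)) = min∞-≤∞ʳ x (min∞-≤∞ˡ z p)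
min∞₃-≤∞ {x}     {y}     (inj₂ (inj₂ p)) = min∞-≤∞ʳ x (min∞-≤∞ʳ y p)

match-costs-regroup : ∀ y₁ x₁ m₁ y₂ x₂ m₂ →
  y₁ + (x₁ + m₁) + (y₂ + (x₂ + m₂)) ≡ x₁ + x₂ + (y₁ + y₂) + (m₁ + m₂)
match-costs-regroup = solve-∀

data Side : Set where
  left right : Side

module _ {A : Set} where

  attach : Side → Tree A → Forest A → Forest A
  attach left  t F = t ∷ F
  attach right t F = F ++ t ∷ []

  splice : Side → Forest A → Forest A → Forest A
  splice left  C F = C ++ F
  splice right C F = F ++ C

  attach-injective : ∀ s {t t′ F F′} → attach s t F ≡ attach s t′ F′ → t ≡ t′ × F ≡ F′
  attach-injective left  eq = ∷-injective eq
  attach-injective right eq = swap (∷ʳ-injective _ _ eq)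

  data Split (s : Side) (F : Forest A) : Set where
    split : ∀ a C R → F ≡ attach s (node a C) R → Split s F

  initLast-++ : ∀ (t : Tree A) ts → t ∷ ts ≡ proj₁ (initLast t ts) ++ proj₂ (initLast t ts) ∷ []
  initLast-++ t []       = refl
  initLast-++ t (u ∷ us) with initLast u us | initLast-++ u us
  ... | _ , _ | eq = cong (t ∷_) eq

  sizeF-++ : ∀ (F G : Forest A) → sizeF (F ++ G) ≡ sizeF F + sizeF G
  sizeF-++ []      G = refl
  sizeF-++ (t ∷ F) G = trans (cong (sizeT t +_) (sizeF-++ F G)) (sym (+-assoc (sizeT t) _ _))

  sizeF-splice : ∀ s C F → sizeF (splice s C F) ≡ sizeF C + sizeF F
  sizeF-splice left  C F = sizeF-++ C F
  sizeF-splice right C F = trans (sizeF-++ F C) (+-comm (sizeF F) _)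

  sizeF-attach : ∀ s a C F → sizeF (attach s (node a C) F) ≡ suc (sizeF (splice s C F))
  sizeF-attach left  a C F = cong suc (sym (sizeF-++ C F))
  sizeF-attach right a C F = begin
    sizeF (F ++ node a C ∷ [])     ≡⟨ sizeF-++ F _ ⟩
    sizeF F + (suc (sizeF C) + 0)  ≡⟨ cong (λ m → sizeF F + suc m) (+-identityʳ _) ⟩
    sizeF F + suc (sizeF C)        ≡⟨ +-suc (sizeF F) _ ⟩
    suc (sizeF F + sizeF C)        ≡⟨ cong suc (sym (sizeF-++ F C)) ⟩
    suc (sizeF (F ++ C))           ∎
    where open ≡-Reasoning

  module _ (s : Side) (a : A) (C R : Forest A) {m n : ℕ} where

    delete-root-sizeˡ : sizeF (attach s (node a C) R) + m ≤ suc n → sizeF (splice s C R) + m ≤ n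
    delete-root-sizeˡ h = ≤-pred (subst (λ x → x + m ≤ suc n) (sizeF-attach s a C R) h)

    delete-root-sizeʳ : m + sizeF (attach s (node a C) R) ≤ suc n → m + sizeF (splice s C R) ≤ n
    delete-root-sizeʳ h =
      ≤-pred (subst (_≤ suc n) (trans (cong (m +_) (sizeF-attach s a C R)) (+-suc m _)) h)

  root-parts-size : ∀ s {a₁ C₁ R₁ a₂ C₂ R₂ n} →
    sizeF (attach s (node a₁ C₁) R₁) + sizeF (attach s (node a₂ C₂) R₂) ≤ suc n →
    sizeF C₁ + sizeF C₂ ≤ n × sizeF R₁ + sizeF R₂ ≤ n
  root-parts-size s {a₁} {C₁} {R₁} {a₂} {C₂} {R₂} {n} h =
    m+n≤o⇒m≤o (sizeF C₁ + sizeF C₂) parts , m+n≤o⇒n≤o (sizeF C₁ + sizeF C₂) parts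
    where
    spliced : sizeF (splice s C₁ R₁) + sizeF (splice s C₂ R₂) ≤ n
    spliced = ≤-trans (+-monoʳ-≤ _ (≤-trans (n≤1+n _) (≤-reflexive (sym (sizeF-attach s a₂ C₂ R₂)))))
                      (delete-root-sizeˡ s a₁ C₁ R₁ h)
    parts : sizeF C₁ + sizeF C₂ + (sizeF R₁ + sizeF R₂) ≤ n
    parts = subst (_≤ n) (trans (cong₂ _+_ (sizeF-splice s C₁ R₁) (sizeF-splice s C₂ R₂))
                                (interchange (sizeF C₁) (sizeF R₁) (sizeF C₂) (sizeF R₂)))
                  spliced

module EditScripts {A : Set} (_≟_ : DecidableEquality A) where

  mismatch : A → A → ℕ
  mismatch a b with a ≟ b
  ... | yes _ = 0
  ... | no  _ = 1

  mismatch-refl : ∀ a → mismatch a a ≡ 0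
  mismatch-refl a with a ≟ a
  ... | yes _  = refl
  ... | no a≢a = ⊥-elim (a≢a refl)

  mismatch≤1+mismatch : ∀ a b c → mismatch a c ≤ suc (mismatch b c)
  mismatch≤1+mismatch a b c with a ≟ c
  ... | yes _ = z≤n
  ... | no  _ = s≤s z≤n

  mismatch-triangle : ∀ a b c → mismatch a b ≤ mismatch a c + mismatch b c
  mismatch-triangle a b c with a ≟ b
  ... | yes _ = z≤n
  ... | no a≢b with a ≟ c | b ≟ c
  ...   | yes refl | yes refl = ⊥-elim (a≢b refl)
  ...   | yes _    | no _     = s≤s z≤n
  ...   | no _     | _        = s≤s z≤n

  data Edit : Forest A → Forest A → ℕ → Set where
    []     : Edit [] [] 0
    delete : ∀ a C {F G c} → Edit (C ++ F) G c → Edit (node a C ∷ F) G (suc c)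
    match  : ∀ a b {C D F G c d} → Edit C D c → Edit F G d →
             Edit (node a C ∷ F) (node b D ∷ G) (d + (c + mismatch a b))

  Edit-refl : ∀ F → Edit F F 0
  Edit-refl []             = []
  Edit-refl (node a C ∷ F) = subst (Edit _ _) (mismatch-refl a) (match a a (Edit-refl C) (Edit-refl F))

  Edit-++ : ∀ {F G F′ G′ c c′} → Edit F G c → Edit F′ G′ c′ → Edit (F ++ F′) (G ++ G′) (c + c′)
  Edit-++ []                 e′ = e′
  Edit-++ {F′ = F′} (delete a C {F} e) e′ =
    delete a C (subst (λ H → Edit H _ _) (++-assoc C F F′) (Edit-++ e e′))
  Edit-++ {c′ = c′} (match a b {c = c} {d} eC eF) e′ =
    subst (Edit _ _) (sym (xy∙z≈xz∙y d (c + mismatch a b) c′)) (match a b eC (Edit-++ eF e′))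

  Edit-deleteAll : ∀ F → Edit F [] (sizeF F)
  Edit-deleteAll []             = []
  Edit-deleteAll (node a C ∷ F) = delete a C (Edit-++ (Edit-deleteAll C) (Edit-deleteAll F))

  delete-last : ∀ {F G c} → Edit F G c → ∀ {a C} L → F ≡ L ++ C → Edit (L ++ node a C ∷ []) G (suc c)
  delete-last e {a} {C} [] refl = delete a C (subst (λ H → Edit H _ _) (sym (++-identityʳ C)) e)
  delete-last (delete b D e) {C = C} (_ ∷ L) refl =
    delete b D (subst (λ H → Edit H _ _) (++-assoc D L _) (delete-last e (D ++ L) (sym (++-assoc D L C))))
  delete-last (match b b′ eD eF) (_ ∷ L) refl = match b b′ eD (delete-last eF L refl)

  delete-at : ∀ s {a C R G c} → Edit (splice s C R) G c → Edit (attach s (node a C) R) G (suc c)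
  delete-at left  e = delete _ _ e
  delete-at right e = delete-last e _ refl

  match-at : ∀ s {a b C D R G c d} → Edit C D c → Edit R G d →
             Edit (attach s (node a C) R) (attach s (node b D) G) (d + (c + mismatch a b))
  match-at left  eC eR = match _ _ eC eR
  match-at right eC eR = Edit-++ eR (match _ _ eC [])

  data EditAt (s : Side) (a : A) (C R G : Forest A) : ℕ → Set where
    deleted : ∀ {c} → Edit (splice s C R) G c → EditAt s a C R G (suc c)
    matched : ∀ b D G′ {c d} → G ≡ attach s (node b D) G′ → Edit C D c → Edit R G′ d →
              EditAt s a C R G (d + (c + mismatch a b))

  editAt-last : ∀ {F G c} → Edit F G c → ∀ {a C} L → F ≡ L ++ node a C ∷ [] → EditAt right a C L G c
  editAt-last [] [] ()
  editAt-last [] (_ ∷ _) ()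
  editAt-last (delete a C e) [] refl = deleted (subst (λ H → Edit H _ _) (++-identityʳ C) e)
  editAt-last (match a b eC eF) [] refl with eF
  ... | [] = matched b _ [] refl eC []
  editAt-last (delete b D e) (_ ∷ L) refl with editAt-last e (D ++ L) (sym (++-assoc D L _))
  ... | deleted e′ = deleted (delete b D (subst (λ H → Edit H _ _) (++-assoc D L _) e′))
  ... | matched b′ D′ G′ eq eC eR = matched b′ D′ G′ eq eC (delete b D eR)
  editAt-last (match b b′ {C = D} {D′} eD eF) (_ ∷ L) refl with editAt-last eF L refl
  ... | deleted e′ = deleted (match b b′ eD e′)
  ... | matched c E G′ {x} {y} eq eC eR =
    subst (EditAt _ _ _ _ _) (xy∙z≈xz∙y y _ (x + mismatch _ c))
      (matched c E (node b′ D′ ∷ G′) (cong (node b′ D′ ∷_) eq) eC (match b b′ eD eR))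

  editAt : ∀ s {a C R G c} → Edit (attach s (node a C) R) G c → EditAt s a C R G c
  editAt left  (delete _ _ e)    = deleted e
  editAt left  (match _ b eC eR) = matched b _ _ refl eC eR
  editAt right e                 = editAt-last e _ refl

  Edit-size : ∀ {F G c} → Edit F G c → sizeF G ≤ sizeF F × sizeF F ≤ sizeF G + c
  Edit-size []                       = z≤n , z≤n
  Edit-size (delete a C {F} {G} {c} e) with Edit-size e
  ... | G≤CF , CF≤G+c =
    m≤n⇒m≤1+n (subst (sizeF G ≤_) (sizeF-++ C F) G≤CF) ,
    subst (λ m → suc m ≤ sizeF G + suc c) (sizeF-++ C F)
      (≤-trans (s≤s CF≤G+c) (≤-reflexive (sym (+-suc (sizeF G) c))))
  Edit-size (match a b {C} {D} {F} {G} {c} {d} eC eF) with Edit-size eC | Edit-size eF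
  ... | D≤C , C≤D+c | G≤F , F≤G+d = s≤s (+-mono-≤ D≤C G≤F) , s≤s (begin
    sizeF C + sizeF F                                ≤⟨ +-mono-≤ C≤D+c F≤G+d ⟩
    sizeF D + c + (sizeF G + d)                      ≡⟨ interchange (sizeF D) c (sizeF G) d ⟩
    sizeF D + sizeF G + (c + d)                      ≤⟨ +-monoʳ-≤ (sizeF D + sizeF G) c+d≤cost ⟩
    sizeF D + sizeF G + (d + (c + mismatch a b))     ∎)
    where
    open ≤-Reasoning
    c+d≤cost : c + d ≤ d + (c + mismatch a b)
    c+d≤cost = ≤-trans (≤-reflexive (+-comm c d)) (+-monoʳ-≤ d (m≤m+n c _))

  Edit-∣size∣ : ∀ {F G c} → Edit F G c → ∣ sizeF F - sizeF G ∣ ≤ c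
  Edit-∣size∣ e with Edit-size e
  ... | G≤F , F≤G+c = subst (_≤ _) (sym (m≤n⇒∣n-m∣≡n∸m G≤F)) (m≤n+o⇒m∸n≤o _ _ F≤G+c)

  Edits-∣size∣ : ∀ {F₁ F₂ G c₁ c₂} → Edit F₁ G c₁ → Edit F₂ G c₂ →
                 ∣ sizeF F₁ - sizeF F₂ ∣ ≤ c₁ + c₂
  Edits-∣size∣ {F₁} {F₂} {G} e₁ e₂ = ≤-trans (∣-∣-triangle (sizeF F₁) (sizeF G) (sizeF F₂))
    (+-mono-≤ (Edit-∣size∣ e₁) (subst (_≤ _) (∣-∣-comm (sizeF F₂) (sizeF G)) (Edit-∣size∣ e₂)))

  Step-++ˡ : ∀ L {F F′ : Forest A} → Step F F′ → Step (L ++ F) (L ++ F′)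
  Step-++ˡ []      st = st
  Step-++ˡ (t ∷ L) st = later t (Step-++ˡ L st)

  Step-++ʳ : ∀ {F F′ : Forest A} R → Step F F′ → Step (F ++ R) (F′ ++ R)
  Step-++ʳ R (relabel a b C F) = relabel a b C (F ++ R)
  Step-++ʳ R (remove a C F)    = subst (Step _) (sym (++-assoc C F R)) (remove a C (F ++ R))
  Step-++ʳ R (inside a F st)   = inside a (F ++ R) st
  Step-++ʳ R (later t st)      = later t (Step-++ʳ R st)

  Edit≤ : Forest A → Forest A → ℕ → Set
  Edit≤ F G c = ∃[ c′ ] (Edit F G c′ × c′ ≤ c)

  Step-Edit : ∀ {F G H c} → Step F G → Edit G H c → Edit≤ F H (suc c)
  Step-Edit (relabel a b C F) (delete _ _ e) = _ , delete a C e , n≤1+n _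
  Step-Edit (relabel a b C F) (match _ d {c = c} {d = cF} eC eF) = _ , match a d eC eF , (begin
    cF + (c + mismatch a d)          ≤⟨ +-monoʳ-≤ cF (+-monoʳ-≤ c (mismatch≤1+mismatch a b d)) ⟩
    cF + (c + suc (mismatch b d))    ≡⟨ cong (cF +_) (+-suc c _) ⟩
    cF + suc (c + mismatch b d)      ≡⟨ +-suc cF _ ⟩
    suc (cF + (c + mismatch b d))    ∎)
    where open ≤-Reasoning
  Step-Edit (remove a C F) e = _ , delete a C e , ≤-refl
  Step-Edit (inside a F st) (delete _ _ e) with Step-Edit (Step-++ʳ F st) e
  ... | _ , e′ , c′≤ = _ , delete a _ e′ , s≤s c′≤
  Step-Edit (inside a F st) (match _ b {c = c} {d} eC eF) with Step-Edit st eC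
  ... | _ , eC′ , c′≤ = _ , match a b eC′ eF ,
    ≤-trans (+-monoʳ-≤ d (+-monoˡ-≤ (mismatch a b) c′≤)) (≤-reflexive (+-suc d _))
  Step-Edit (later _ st) (delete a C e) with Step-Edit (Step-++ˡ C st) e
  ... | _ , e′ , c′≤ = _ , delete a C e′ , s≤s c′≤
  Step-Edit (later _ st) (match a b eC eF) with Step-Edit st eF
  ... | _ , eF′ , d′≤ = _ , match a b eC eF′ , +-monoˡ-≤ _ d′≤

  Steps→Edit : ∀ {F G c} → Steps c F G → Edit≤ F G c
  Steps→Edit {F} done = 0 , Edit-refl F , z≤n
  Steps→Edit (step st sts) with Steps→Edit sts
  ... | _ , e , c′≤ with Step-Edit st e
  ...   | _ , e′ , c″≤ = _ , e′ , ≤-trans c″≤ (s≤s c′≤)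

  _◅◅_ : ∀ {m n} {F G H : Forest A} → Steps m F G → Steps n G H → Steps (m + n) F H
  done         ◅◅ sts′ = sts′
  step st sts ◅◅ sts′ = step st (sts ◅◅ sts′)

  Steps-inside : ∀ {c} (a : A) (F : Forest A) {C D} → Steps c C D → Steps c (node a C ∷ F) (node a D ∷ F)
  Steps-inside a F done          = done
  Steps-inside a F (step st sts) = step (inside a F st) (Steps-inside a F sts)

  Steps-later : ∀ {c} (t : Tree A) {F G} → Steps c F G → Steps c (t ∷ F) (t ∷ G)
  Steps-later t done          = done
  Steps-later t (step st sts) = step (later t st) (Steps-later t sts)

  Steps-relabel : ∀ a b C F → Steps (mismatch a b) (node a C ∷ F) (node b C ∷ F)
  Steps-relabel a b C F with a ≟ b
  ... | yes refl = done
  ... | no  _    = step (relabel a b C F) done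

  Edit→Steps : ∀ {F G c} → Edit F G c → Steps c F G
  Edit→Steps []             = done
  Edit→Steps (delete a C e) = step (remove a C _) (Edit→Steps e)
  Edit→Steps (match a b {C} {D} {F} {G} eC eF) =
    Steps-later (node a C) (Edit→Steps eF) ◅◅ (Steps-inside a G (Edit→Steps eC) ◅◅ Steps-relabel a b D G)

  data Realized (F₁ F₂ : Forest A) : ℕ∞ → Set where
    infinite : Realized F₁ F₂ ∞
    edits    : ∀ {G c₁ c₂} → Edit F₁ G c₁ → Edit F₂ G c₂ → Realized F₁ F₂ (fin (c₁ + c₂))

  realized-cost : ∀ {F₁ F₂ v w} → v ≡ w → Realized F₁ F₂ (fin v) → Realized F₁ F₂ (fin w)
  realized-cost refl r = r

  Realized→Transformable : ∀ {F₁ F₂ v} → Realized F₁ F₂ (fin v) → Transformable F₁ F₂ v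
  Realized→Transformable (edits e₁ e₂) = _ , _ , _ , Edit→Steps e₁ , Edit→Steps e₂ , refl

  min∞-realized : ∀ {F₁ F₂ x y} → Realized F₁ F₂ x → Realized F₁ F₂ y → Realized F₁ F₂ (min∞ x y)
  min∞-realized infinite      q        = q
  min∞-realized (edits e₁ e₂) infinite = edits e₁ e₂
  min∞-realized p@(edits {c₁ = c₁} {c₂} _ _) q@(edits {c₁ = c₁′} {c₂′} _ _)
    with ⊓-sel (c₁ + c₂) (c₁′ + c₂′)
  ... | inj₁ ⊓≡ˡ = realized-cost (sym ⊓≡ˡ) p
  ... | inj₂ ⊓≡ʳ = realized-cost (sym ⊓≡ʳ) q

  deleteˡ-realized : ∀ s {a C R F₂ x} → Realized (splice s C R) F₂ x →
                     Realized (attach s (node a C) R) F₂ (x ⊕ fin 1)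
  deleteˡ-realized s infinite                        = infinite
  deleteˡ-realized s (edits {c₁ = c₁} {c₂} e₁ e₂) =
    realized-cost (+-comm 1 (c₁ + c₂)) (edits (delete-at s e₁) e₂)

  deleteʳ-realized : ∀ s {a C R F₁ x} → Realized F₁ (splice s C R) x →
                     Realized F₁ (attach s (node a C) R) (x ⊕ fin 1)
  deleteʳ-realized s infinite                        = infinite
  deleteʳ-realized s (edits {c₁ = c₁} {c₂} e₁ e₂) =
    realized-cost (trans (+-suc c₁ c₂) (+-comm 1 (c₁ + c₂))) (edits e₁ (delete-at s e₂))

  match-realized : ∀ s {a₁ C₁ R₁ a₂ C₂ R₂ x y} → Realized C₁ C₂ x → Realized R₁ R₂ y →
    Realized (attach s (node a₁ C₁) R₁) (attach s (node a₂ C₂) R₂) ((x ⊕ y) ⊕ fin (mismatch a₁ a₂))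
  match-realized s infinite      _        = infinite
  match-realized s (edits _ _)   infinite = infinite
  match-realized s {a₁} {a₂ = a₂} (edits {c₁ = x₁} {x₂} eC₁ eC₂) (edits {c₁ = y₁} {y₂} eR₁ eR₂) =
    realized-cost cost (edits (match-at s {a₁} {a₂} eC₁ eR₁) (match-at s {a₂} {a₂} eC₂ eR₂))
    where
    open ≡-Reasoning
    mismatch-refl-right : mismatch a₁ a₂ + mismatch a₂ a₂ ≡ mismatch a₁ a₂
    mismatch-refl-right = trans (cong (mismatch a₁ a₂ +_) (mismatch-refl a₂)) (+-identityʳ _)
    cost : y₁ + (x₁ + mismatch a₁ a₂) + (y₂ + (x₂ + mismatch a₂ a₂)) ≡
           x₁ + x₂ + (y₁ + y₂) + mismatch a₁ a₂
    cost = begin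
      y₁ + (x₁ + mismatch a₁ a₂) + (y₂ + (x₂ + mismatch a₂ a₂))  ≡⟨ match-costs-regroup y₁ x₁ _ y₂ x₂ _ ⟩
      x₁ + x₂ + (y₁ + y₂) + (mismatch a₁ a₂ + mismatch a₂ a₂)    ≡⟨ cong (x₁ + x₂ + (y₁ + y₂) +_) mismatch-refl-right ⟩
      x₁ + x₂ + (y₁ + y₂) + mismatch a₁ a₂                       ∎

module Recursion {A : Set} (_≟_ : DecidableEquality A)
         (S : Forest A → Forest A → Set) (S? : ∀ F₁ F₂ → Dec (S F₁ F₂)) where

  open EditScripts _≟_

  δ≡mismatch : ∀ a b → δ _≟_ S S? a b ≡ mismatch a b
  δ≡mismatch a b with a ≟ b
  ... | yes _ = refl
  ... | no  _ = refl

  branch : (Forest A → Forest A → ℕ∞) → ∀ {s F₁ F₂} → Split s F₁ → Split s F₂ → ℕ∞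
  branch W {s} {F₁} {F₂} (split r₁ C₁ R₁ _) (split r₂ C₂ R₂ _) =
    min∞ (W (splice s C₁ R₁) F₂ ⊕ fin 1)
    (min∞ (W F₁ (splice s C₂ R₂) ⊕ fin 1)
          ((W C₁ C₂ ⊕ W R₁ R₂) ⊕ fin (δ _≟_ S S? r₁ r₂)))

  data GoView : ℕ → Forest A → Forest A → ℕ∞ → Set where
    excluded  : ∀ {n F₁ F₂} → S F₁ F₂ → GoView n F₁ F₂ ∞
    emptyˡ    : ∀ {n F} → GoView n [] F (fin (sizeF F))
    emptyʳ    : ∀ {n F} → GoView n F [] (fin (sizeF F))
    exhausted : ∀ {a C R₁ t₂ R₂} → GoView zero (node a C ∷ R₁) (t₂ ∷ R₂) ∞
    branches  : ∀ {n s F₁ F₂} (v₁ : Split s F₁) (v₂ : Split s F₂) →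
                GoView (suc n) F₁ F₂ (branch (go _≟_ S S? n) v₁ v₂)

  go-view : ∀ n F₁ F₂ → GoView n F₁ F₂ (go _≟_ S S? n F₁ F₂)
  go-view n F₁ F₂ with S? F₁ F₂
  go-view n F₁ F₂ | yes ∈S = excluded ∈S
  go-view n [] F₂ | no _ = emptyˡ
  go-view n (t ∷ R) [] | no _ = emptyʳ
  go-view zero (node a C ∷ R₁) (t₂ ∷ R₂) | no _ = exhausted
  go-view (suc n) (node a C ∷ R₁) (node b D ∷ R₂) | no _
    with initLast (node a C) R₁ | initLast-++ (node a C) R₁ | initLast (node b D) R₂ | initLast-++ (node b D) R₂
  ... | L₁ , node r₁ C₁ | shape₁ | L₂ , node r₂ C₂ | shape₂
    with sizeT (node a C) ≤ᵇ sizeT (node r₁ C₁)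
  ... | true  = branches {s = left} (split a C R₁ refl) (split b D R₂ refl)
  ... | false = branches {s = right} (split r₁ C₁ L₁ shape₁) (split r₂ C₂ L₂ shape₂)

  Sound : (Forest A → Forest A → ℕ∞) → Set
  Sound W = ∀ F₁ F₂ → Realized F₁ F₂ (W F₁ F₂)

  branch-sound : ∀ {W s F₁ F₂} → Sound W → (v₁ : Split s F₁) (v₂ : Split s F₂) →
                 Realized F₁ F₂ (branch W v₁ v₂)
  branch-sound {W} {s} sound (split r₁ C₁ R₁ refl) (split r₂ C₂ R₂ refl) =
    min∞-realized (deleteˡ-realized s (sound (splice s C₁ R₁) _))
    (min∞-realized (deleteʳ-realized s (sound _ (splice s C₂ R₂)))
      (subst (λ m → Realized _ _ ((W C₁ C₂ ⊕ W R₁ R₂) ⊕ fin m)) (sym (δ≡mismatch r₁ r₂))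
        (match-realized s (sound C₁ C₂) (sound R₁ R₂))))

  go-sound : ∀ n → Sound (go _≟_ S S? n)
  go-sound n F₁ F₂ with go _≟_ S S? n F₁ F₂ | go-view n F₁ F₂
  ... | _ | excluded _     = infinite
  ... | _ | emptyˡ         = edits [] (Edit-deleteAll F₂)
  ... | _ | emptyʳ         = realized-cost (+-identityʳ (sizeF F₁)) (edits (Edit-deleteAll F₁) [])
  ... | _ | exhausted      = infinite
  ... | _ | branches v₁ v₂ = branch-sound (go-sound _) v₁ v₂

  V-sound : ∀ F₁ F₂ → Realized F₁ F₂ (V _≟_ S S? F₁ F₂)
  V-sound F₁ F₂ = go-sound _ F₁ F₂

  module Budget (k : ℕ) where

    CompleteUpTo : (Forest A → Forest A → ℕ∞) → ℕ → Set
    CompleteUpTo W n = ∀ {F₁ F₂ G c₁ c₂} → Edit F₁ G c₁ → Edit F₂ G c₂ → c₁ + c₂ ≤ k →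
                       sizeF F₁ + sizeF F₂ ≤ n → W F₁ F₂ ≤∞ c₁ + c₂

    match-option : ∀ {W n C₁ C₂ R₁ R₂ D G x₁ x₂ y₁ y₂ m₁ m₂ d} → CompleteUpTo W n →
      Edit C₁ D x₁ → Edit C₂ D x₂ → Edit R₁ G y₁ → Edit R₂ G y₂ →
      y₁ + (x₁ + m₁) + (y₂ + (x₂ + m₂)) ≤ k →
      sizeF C₁ + sizeF C₂ ≤ n × sizeF R₁ + sizeF R₂ ≤ n → d ≤ m₁ + m₂ →
      (W C₁ C₂ ⊕ W R₁ R₂) ⊕ fin d ≤∞ y₁ + (x₁ + m₁) + (y₂ + (x₂ + m₂))
    match-option {x₁ = x₁} {x₂} {y₁} {y₂} {m₁} {m₂} complete eC₁ eC₂ eR₁ eR₂ c≤k (C≤n , R≤n) d≤m =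
      ≤∞-weaken (⊕-≤∞ (⊕-≤∞ (complete eC₁ eC₂ (m+n≤o⇒m≤o (x₁ + x₂) parts≤k) C≤n)
                            (complete eR₁ eR₂ (m+n≤o⇒n≤o (x₁ + x₂) parts≤k) R≤n))
                      (fin≤ d≤m))
                (≤-reflexive (sym regroup))
      where
      regroup : y₁ + (x₁ + m₁) + (y₂ + (x₂ + m₂)) ≡ x₁ + x₂ + (y₁ + y₂) + (m₁ + m₂)
      regroup = match-costs-regroup y₁ x₁ m₁ y₂ x₂ m₂
      parts≤k : x₁ + x₂ + (y₁ + y₂) ≤ k
      parts≤k = m+n≤o⇒m≤o (x₁ + x₂ + (y₁ + y₂)) (subst (_≤ k) regroup c≤k)

    branch-options : ∀ {W n} s {r₁ C₁ R₁ r₂ C₂ R₂ G c₁ c₂} → CompleteUpTo W n →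
      Edit (attach s (node r₁ C₁) R₁) G c₁ → Edit (attach s (node r₂ C₂) R₂) G c₂ → c₁ + c₂ ≤ k →
      sizeF (attach s (node r₁ C₁) R₁) + sizeF (attach s (node r₂ C₂) R₂) ≤ suc n →
      W (splice s C₁ R₁) (attach s (node r₂ C₂) R₂) ⊕ fin 1 ≤∞ c₁ + c₂ ⊎
      W (attach s (node r₁ C₁) R₁) (splice s C₂ R₂) ⊕ fin 1 ≤∞ c₁ + c₂ ⊎
      (W C₁ C₂ ⊕ W R₁ R₂) ⊕ fin (δ _≟_ S S? r₁ r₂) ≤∞ c₁ + c₂
    branch-options s {r₁} {C₁} {R₁} {r₂} {C₂} {R₂} complete e₁ e₂ c≤k size≤
      with editAt s e₁ | editAt s e₂
    ... | deleted e₁′ | _ =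
      inj₁ (⊕1-≤∞ (complete e₁′ e₂ (<⇒≤ c≤k) (delete-root-sizeˡ s r₁ C₁ R₁ size≤)))
    ... | matched _ _ _ _ _ _ | deleted e₂′ =
      inj₂ (inj₁ (≤∞-weaken
        (⊕1-≤∞ (complete e₁ e₂′ (≤-trans (+-monoʳ-≤ _ (n≤1+n _)) c≤k)
                                 (delete-root-sizeʳ s r₂ C₂ R₂ size≤)))
        (≤-reflexive (sym (+-suc _ _)))))
    ... | matched b D G refl eC₁ eR₁ | matched _ _ _ eq eC₂ eR₂ with attach-injective s eq
    ...   | refl , refl = inj₂ (inj₂ (match-option complete eC₁ eC₂ eR₁ eR₂ c≤k
              (root-parts-size s size≤)
              (subst (_≤ _) (sym (δ≡mismatch r₁ r₂)) (mismatch-triangle r₁ r₂ b))))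

    module _ (S-unbalanced : ∀ F₁ F₂ → S F₁ F₂ → k < ∣ sizeF F₁ - sizeF F₂ ∣) where

      go-complete : ∀ n → CompleteUpTo (go _≟_ S S? n) n
      go-complete n {F₁} {F₂} e₁ e₂ c≤k size≤ with go _≟_ S S? n F₁ F₂ | go-view n F₁ F₂
      ... | _ | excluded ∈S =
        ⊥-elim (<⇒≱ (S-unbalanced F₁ F₂ ∈S) (≤-trans (Edits-∣size∣ e₁ e₂) c≤k))
      ... | _ | emptyˡ = fin≤ (Edits-∣size∣ e₁ e₂)
      ... | _ | emptyʳ = fin≤ (subst (_≤ _) (∣-∣-identityʳ (sizeF F₁)) (Edits-∣size∣ e₁ e₂))
      ... | _ | branches {s = s} (split _ _ _ refl) (split _ _ _ refl) =
        min∞₃-≤∞ (branch-options s (go-complete _) e₁ e₂ c≤k size≤)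
      go-complete zero {node a C ∷ R₁} e₁ e₂ c≤k () | _ | exhausted

      V-complete : ∀ {F₁ F₂ c} → Transformable F₁ F₂ c → c ≤ k → V _≟_ S S? F₁ F₂ ≤∞ c
      V-complete (_ , c₁ , c₂ , sts₁ , sts₂ , refl) c≤k with Steps→Edit sts₁ | Steps→Edit sts₂
      ... | c₁′ , e₁ , c₁′≤c₁ | c₂′ , e₂ , c₂′≤c₂ =
        ≤∞-weaken (go-complete _ e₁ e₂ (≤-trans c′≤c c≤k) ≤-refl) c′≤c
        where
        c′≤c : c₁′ + c₂′ ≤ c₁ + c₂
        c′≤c = +-mono-≤ c₁′≤c₁ c₂′≤c₂

      V≡ed : ∀ {F₁ F₂ d} → IsEd F₁ F₂ d → d ≤ k → V _≟_ S S? F₁ F₂ ≡ fin d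
      V≡ed {F₁} {F₂} (d-transformable , d-minimal) d≤k
        with V _≟_ S S? F₁ F₂ | V-complete d-transformable d≤k | V-sound F₁ F₂
      ... | fin v | fin≤ v≤d | v-realized =
        cong fin (≤-antisym v≤d (d-minimal v (Realized→Transformable v-realized)))

proposition8 : {A : Set} (_≟_ : DecidableEquality A)
    (T₁ T₂ : Tree A) (k d : ℕ) →
    IsEd (T₁ ∷ []) (T₂ ∷ []) d → d ≤ k →
    (S : Forest A → Forest A → Set) (S? : ∀ F₁ F₂ → Dec (S F₁ F₂)) →
    (∀ F₁ F₂ → S F₁ F₂ ⇔ (IsSubforest T₁ F₁ × IsSubforest T₂ F₂ × k < ∣ sizeF F₁ - sizeF F₂ ∣)) →
    V _≟_ S S? (T₁ ∷ []) (T₂ ∷ []) ≡ fin d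
proposition8 _≟_ T₁ T₂ k d isEd d≤k S S? S⇔ =
  Recursion.Budget.V≡ed _≟_ S S? k S-unbalanced isEd d≤k
  where
  S-unbalanced : ∀ F₁ F₂ → S F₁ F₂ → k < ∣ sizeF F₁ - sizeF F₂ ∣
  S-unbalanced F₁ F₂ ∈S = proj₂ (proj₂ (Equivalence.to (S⇔ F₁ F₂) ∈S))
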